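{- For all non-negative integers $n,k,\ell$, the profile map $\phi$ is a bijection from $\mathcal{L}_1(n,k,\ell)$ to $\mathcal{W}(n,k,\ell)$.
   Context: A two-color partition is a partition each of whose parts is colored red or green. $\mathcal{L}_1(n,k,\ell)$ is the set of two-color partitions $\lambda_1>\lambda_2>\cdots>\lambda_m$ of $n$ into numerically distinct parts, with exactly $k$ red and $\ell$ green parts, such that each green part $\lambda_i$ with $i<m$ satisfies $\lambda_i-\lambda_{i+1}\ge 2$, and no part equals $1$ with green color. Draw the Ferrers graph in English notation (row $i$ from the top has $\lambda_i$ left-justified cells). The profile is the border path from the south-west corner to the north-east corner consisting of unit north steps $N$ and east steps $E$. Define $\phi(\lambda)$ as the word over the alphabet $\{x,y,z\}$ obtained by traversing the profile and labelling: each pair of consecutive steps $EN$ whose $E$ step lies under the last cell of a red part is labelled $x$; each triple of consecutive steps $EEN$ whose $E$ steps lie under the last two cells of a green part is labelled $z$; every remaining east step is labelled $y$. (E.g. $12_g+8_g+6_r+4_r+3_g+1_r\mapsto xzxyxzyyz$.) Let $\mathcal{W}$ be the set of words over $\{x,y,z\}$ that are empty or end with $x$ or $z$. For $u=u_1\cdots u_m$ define the weight $\omega(u)=\sum_{i=1}^m \chi(u_i\ne y)\,(i+|\{j\le i: u_j=z\}|)$, where $\chi(S)$ is $1$ if $S$ holds and $0$ otherwise. $\mathcal{W}(n,k,\ell)$ is the set of words in $\mathcal{W}$ of weight $n$ with exactly $k$ letters $x$ and $\ell$ letters $z$. -}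

module Defs where

open import Data.Nat using (ℕ; zero; suc; _+_; _∸_; _≤_; _<_)
open import Data.List using (List; []; _∷_; _++_; replicate)
open import Data.Product using (_×_; _,_)
open import Data.Unit using (⊤)
open import Relation.Binary.PropositionalEquality using (_≡_; _≢_)

data Color : Set where
  red green : Color

Part : Set
Part = ℕ × Color

-- A two-colour partition is listed as λ₁ ∷ λ₂ ∷ … ∷ λₘ ∷ [] (largest first).
TwoColorPartition : Set
TwoColorPartition = List Part

size : TwoColorPartition → ℕ
size [] = 0
size ((a , _) ∷ p) = a + size p

numRed : TwoColorPartition → ℕ
numRed [] = 0
numRed ((_ , red) ∷ p) = suc (numRed p)
numRed ((_ , green) ∷ p) = numRed p

numGreen : TwoColorPartition → ℕ
numGreen [] = 0
numGreen ((_ , red) ∷ p) = numGreen p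
numGreen ((_ , green) ∷ p) = suc (numGreen p)

StrictlyDecreasing : TwoColorPartition → Set
StrictlyDecreasing [] = ⊤
StrictlyDecreasing ((a , _) ∷ []) = 1 ≤ a
StrictlyDecreasing ((a , _) ∷ ((b , d) ∷ p)) = b < a × StrictlyDecreasing ((b , d) ∷ p)

GreenGap : TwoColorPartition → Set
GreenGap [] = ⊤
GreenGap ((a , _) ∷ []) = ⊤
GreenGap ((a , red) ∷ ((b , d) ∷ p)) = GreenGap ((b , d) ∷ p)
GreenGap ((a , green) ∷ ((b , d) ∷ p)) = 2 + b ≤ a × GreenGap ((b , d) ∷ p)

NoGreenOne : TwoColorPartition → Set
NoGreenOne [] = ⊤
NoGreenOne ((a , red) ∷ p) = NoGreenOne p
NoGreenOne ((a , green) ∷ p) = a ≢ 1 × NoGreenOne p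

InL1 : ℕ → ℕ → ℕ → TwoColorPartition → Set
InL1 n k ℓ p =
  StrictlyDecreasing p × GreenGap p × NoGreenOne p ×
  size p ≡ n × numRed p ≡ k × numGreen p ≡ ℓ

data Letter : Set where
  x y z : Letter

Word : Set
Word = List Letter

EndsWell : Word → Set
EndsWell [] = ⊤
EndsWell (a ∷ []) = a ≢ y
EndsWell (a ∷ (b ∷ u)) = EndsWell (b ∷ u)

numX : Word → ℕ
numX [] = 0
numX (x ∷ u) = suc (numX u)
numX (y ∷ u) = numX u
numX (z ∷ u) = numX u

numZ : Word → ℕ
numZ [] = 0
numZ (x ∷ u) = numZ u
numZ (y ∷ u) = numZ u
numZ (z ∷ u) = suc (numZ u)

-- ω(u) = Σᵢ χ(uᵢ ≠ y) (i + |{j ≤ i : uⱼ = z}|), positions 1-indexed.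
-- weightFrom i c u : u starts at position i, and c letters z precede it.
weightFrom : ℕ → ℕ → Word → ℕ
weightFrom i c [] = 0
weightFrom i c (x ∷ u) = (i + c) + weightFrom (suc i) c u
weightFrom i c (y ∷ u) = weightFrom (suc i) c u
weightFrom i c (z ∷ u) = (i + suc c) + weightFrom (suc i) (suc c) u

weight : Word → ℕ
weight u = weightFrom 1 0 u

InW : ℕ → ℕ → ℕ → Word → Set
InW n k ℓ u = EndsWell u × weight u ≡ n × numX u ≡ k × numZ u ≡ ℓ

-- The profile from the SW corner to the NE corner is
--   E^{λₘ} N E^{λₘ₋₁-λₘ} N ⋯ E^{λ₁-λ₂} N,
-- i.e. for i = m, m-1, …, 1 a segment of dᵢ = λᵢ - λᵢ₊₁ east steps
-- (λₘ₊₁ = 0), which lie under the last dᵢ cells of row i, followed by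
-- a north step.  Labelling: for a red row the final "EN" becomes x, the
-- remaining dᵢ-1 east steps become y; for a green row the final "EEN"
-- becomes z, the remaining dᵢ-2 east steps become y.

labelSegment : ℕ → Color → Word
labelSegment d red = replicate (d ∸ 1) y ++ (x ∷ [])
labelSegment d green = replicate (d ∸ 2) y ++ (z ∷ [])

nextPart : TwoColorPartition → ℕ
nextPart [] = 0
nextPart ((b , _) ∷ _) = b

φ : TwoColorPartition → Word
φ [] = []
φ ((a , c) ∷ p) = φ p ++ labelSegment (a ∸ nextPart p) c

-- Reading φ(λ) from left to right climbs the profile row by row: a block
-- of y's followed by x or z encodes one part, the letter giving its colour
-- and the block length plus one (for x) or two (for z) giving the gap to
-- the part below.  The gap conditions of 𝓛₁ say exactly that every gap is
-- at least the one or two east steps that x or z occupy, so φ is inverted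
-- by reading the word and stacking parts.  A non-y letter is weighted by
-- the number of east steps of the profile up to and including it, which
-- is the part it closes; hence ω(φ(λ)) = |λ|.

module Submission where

open import Defs
open import Data.Nat using (ℕ; zero; suc; _+_; _∸_; _≤_)
open import Data.Nat.Properties
  using (+-suc; +-identityʳ; +-assoc; +-comm; m≤n+m; +-monoˡ-≤; ≤-trans; ≤-reflexive;
         m+n≤o⇒n≤o; m+n≤o⇒m≤o; m+n≤o⇒m≤o∸n; m+n∸m≡n; m+n∸n≡m; m+[n∸m]≡n; m∸n+n≡m;
         >⇒≢; ≤∧≢⇒<)
open import Data.List using ([]; _∷_; _++_; _∷ʳ_; replicate)
open import Data.List.Properties using (++-assoc; ++-identityʳ; ∷ʳ-++)
open import Data.Product using (_×_; Σ; _,_; proj₁; proj₂)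
open import Data.Unit using (tt)
open import Relation.Nullary using (¬_)
open import Relation.Binary.PropositionalEquality
  using (_≡_; refl; sym; trans; cong; cong₂; subst; ≢-sym; module ≡-Reasoning)
open ≡-Reasoning

Admissible : TwoColorPartition → Set
Admissible p = StrictlyDecreasing p × GreenGap p × NoGreenOne p

InL1⇒Admissible : ∀ {n k ℓ} p → InL1 n k ℓ p → Admissible p
InL1⇒Admissible p (sd , gg , ng , _) = sd , gg , ng

-- The least admissible difference between a part of colour c and the next
-- part, i.e. the number of east steps taken by the letter mark c.
gap : Color → ℕ
gap red = 1
gap green = 2

mark : Color → Letter
mark red = x
mark green = z

segment : Color → ℕ → Word
segment c k = replicate k y ∷ʳ mark c

labelSegment≡segment : ∀ d c → labelSegment d c ≡ segment c (d ∸ gap c)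
labelSegment≡segment d red = refl
labelSegment≡segment d green = refl

admissible-tail : ∀ {a} c p → Admissible ((a , c) ∷ p) → Admissible p
admissible-tail c [] _ = tt , tt , tt
admissible-tail red ((b , d) ∷ p) (sd , gg , ng) = proj₂ sd , gg , ng
admissible-tail green ((b , d) ∷ p) (sd , gg , ng) = proj₂ sd , proj₂ gg , proj₂ ng

admissible-head : ∀ {a} c p → Admissible ((a , c) ∷ p) → gap c + nextPart p ≤ a
admissible-head red [] (sd , _) = sd
admissible-head green [] (sd , _ , (a≢1 , _)) = ≤∧≢⇒< sd (≢-sym a≢1)
admissible-head red ((b , d) ∷ p) ((b<a , _) , _) = b<a
admissible-head green ((b , d) ∷ p) (_ , (2+b≤a , _) , _) = 2+b≤a

admissible-∷ : ∀ {a} c p → Admissible p → gap c + nextPart p ≤ a → Admissible ((a , c) ∷ p)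
admissible-∷ red [] _ 1≤a = 1≤a , tt , tt
admissible-∷ green [] _ 2≤a = m+n≤o⇒m≤o 1 2≤a , tt , (>⇒≢ 2≤a , tt)
admissible-∷ red ((b , d) ∷ p) (sd , gg , ng) b<a = (b<a , sd) , gg , ng
admissible-∷ green ((b , d) ∷ p) (sd , gg , ng) 2+b≤a =
  (m+n≤o⇒n≤o 1 2+b≤a , sd) , (2+b≤a , gg) , (>⇒≢ (m+n≤o⇒m≤o 2 2+b≤a) , ng)

-- A part a of colour c above a part b is encoded by a ∸ b ∸ gap c letters y.
segment-height : ∀ {a b} g → g + b ≤ a → b + ((a ∸ b ∸ g) + g) ≡ a
segment-height {a} {b} g g+b≤a = begin
  b + ((a ∸ b ∸ g) + g)  ≡⟨ cong (b +_) (m∸n+n≡m (m+n≤o⇒m≤o∸n g g+b≤a)) ⟩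
  b + (a ∸ b)            ≡⟨ m+[n∸m]≡n (m+n≤o⇒n≤o g g+b≤a) ⟩
  a                      ∎

numX-++ : ∀ v w → numX (v ++ w) ≡ numX v + numX w
numX-++ [] w = refl
numX-++ (x ∷ v) w = cong suc (numX-++ v w)
numX-++ (y ∷ v) w = numX-++ v w
numX-++ (z ∷ v) w = numX-++ v w

numZ-++ : ∀ v w → numZ (v ++ w) ≡ numZ v + numZ w
numZ-++ [] w = refl
numZ-++ (x ∷ v) w = numZ-++ v w
numZ-++ (y ∷ v) w = numZ-++ v w
numZ-++ (z ∷ v) w = cong suc (numZ-++ v w)

numX-replicate-y : ∀ k w → numX (replicate k y ++ w) ≡ numX w
numX-replicate-y zero w = refl
numX-replicate-y (suc k) w = numX-replicate-y k w

numZ-replicate-y : ∀ k w → numZ (replicate k y ++ w) ≡ numZ w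
numZ-replicate-y zero w = refl
numZ-replicate-y (suc k) w = numZ-replicate-y k w

-- Number of east steps of the profile described by a word.
width : Word → ℕ
width [] = 0
width (x ∷ u) = suc (width u)
width (y ∷ u) = suc (width u)
width (z ∷ u) = suc (suc (width u))

width-++ : ∀ v w → width (v ++ w) ≡ width v + width w
width-++ [] w = refl
width-++ (x ∷ v) w = cong suc (width-++ v w)
width-++ (y ∷ v) w = cong suc (width-++ v w)
width-++ (z ∷ v) w = cong (λ n → suc (suc n)) (width-++ v w)

width-segment : ∀ c k → width (segment c k) ≡ k + gap c
width-segment red zero = refl
width-segment green zero = refl
width-segment c (suc k) = cong suc (width-segment c k)

-- ω read off the profile: a non-y letter contributes the number of east
-- steps up to and including it, s being the steps already taken (in
-- weightFrom, position i + 1 after c letters z starts after i + c steps).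
weightAfter : ℕ → Word → ℕ
weightAfter s [] = 0
weightAfter s (x ∷ u) = (s + 1) + weightAfter (s + 1) u
weightAfter s (y ∷ u) = weightAfter (s + 1) u
weightAfter s (z ∷ u) = (s + 2) + weightAfter (s + 2) u

weightFrom≡weightAfter : ∀ i c u → weightFrom (suc i) c u ≡ weightAfter (i + c) u
weightFrom≡weightAfter i c [] = refl
weightFrom≡weightAfter i c (x ∷ u) =
  cong₂ _+_ steps (trans (weightFrom≡weightAfter (suc i) c u) (cong (λ s → weightAfter s u) steps))
  where steps = +-comm 1 (i + c)
weightFrom≡weightAfter i c (y ∷ u) =
  trans (weightFrom≡weightAfter (suc i) c u) (cong (λ s → weightAfter s u) (+-comm 1 (i + c)))
weightFrom≡weightAfter i c (z ∷ u) =
  cong₂ _+_ steps (trans (weightFrom≡weightAfter (suc i) (suc c) u) (cong (λ s → weightAfter s u) steps))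
  where steps = trans (cong suc (+-suc i c)) (+-comm 2 (i + c))

weightAfter-++ : ∀ s v w → weightAfter s (v ++ w) ≡ weightAfter s v + weightAfter (s + width v) w
weightAfter-++ s [] w = cong (λ t → weightAfter t w) (sym (+-identityʳ s))
weightAfter-++ s (x ∷ v) w = begin
  (s + 1) + weightAfter (s + 1) (v ++ w)
    ≡⟨ cong ((s + 1) +_) (weightAfter-++ (s + 1) v w) ⟩
  (s + 1) + (weightAfter (s + 1) v + weightAfter (s + 1 + width v) w)
    ≡⟨ sym (+-assoc (s + 1) _ _) ⟩
  (s + 1) + weightAfter (s + 1) v + weightAfter (s + 1 + width v) w
    ≡⟨ cong (λ t → (s + 1) + weightAfter (s + 1) v + weightAfter t w) (+-assoc s 1 (width v)) ⟩
  (s + 1) + weightAfter (s + 1) v + weightAfter (s + width (x ∷ v)) w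
    ∎
weightAfter-++ s (y ∷ v) w = begin
  weightAfter (s + 1) (v ++ w)
    ≡⟨ weightAfter-++ (s + 1) v w ⟩
  weightAfter (s + 1) v + weightAfter (s + 1 + width v) w
    ≡⟨ cong (λ t → weightAfter (s + 1) v + weightAfter t w) (+-assoc s 1 (width v)) ⟩
  weightAfter (s + 1) v + weightAfter (s + width (y ∷ v)) w
    ∎
weightAfter-++ s (z ∷ v) w = begin
  (s + 2) + weightAfter (s + 2) (v ++ w)
    ≡⟨ cong ((s + 2) +_) (weightAfter-++ (s + 2) v w) ⟩
  (s + 2) + (weightAfter (s + 2) v + weightAfter (s + 2 + width v) w)
    ≡⟨ sym (+-assoc (s + 2) _ _) ⟩
  (s + 2) + weightAfter (s + 2) v + weightAfter (s + 2 + width v) w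
    ≡⟨ cong (λ t → (s + 2) + weightAfter (s + 2) v + weightAfter t w) (+-assoc s 2 (width v)) ⟩
  (s + 2) + weightAfter (s + 2) v + weightAfter (s + width (z ∷ v)) w
    ∎

weightAfter-segment : ∀ s c k → weightAfter s (segment c k) ≡ s + (k + gap c)
weightAfter-segment s red zero = +-identityʳ (s + 1)
weightAfter-segment s green zero = +-identityʳ (s + 2)
weightAfter-segment s c (suc k) = begin
  weightAfter (s + 1) (segment c k)  ≡⟨ weightAfter-segment (s + 1) c k ⟩
  s + 1 + (k + gap c)                ≡⟨ +-assoc s 1 (k + gap c) ⟩
  s + (suc k + gap c)                ∎

EndsWell-++⁺ : ∀ v {b w} → EndsWell (b ∷ w) → EndsWell (v ++ b ∷ w)
EndsWell-++⁺ [] e = e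
EndsWell-++⁺ (a ∷ []) e = e
EndsWell-++⁺ (a ∷ a′ ∷ v) e = EndsWell-++⁺ (a′ ∷ v) e

EndsWell-++⁻ : ∀ v {b w} → EndsWell (v ++ b ∷ w) → EndsWell (b ∷ w)
EndsWell-++⁻ [] e = e
EndsWell-++⁻ (a ∷ []) e = e
EndsWell-++⁻ (a ∷ a′ ∷ v) e = EndsWell-++⁻ (a′ ∷ v) e

EndsWell-∷⁻ : ∀ {a} u → EndsWell (a ∷ u) → EndsWell u
EndsWell-∷⁻ [] _ = tt
EndsWell-∷⁻ (b ∷ u) e = e

¬EndsWell-y⁺ : ∀ k → ¬ EndsWell (replicate (suc k) y ++ [])
¬EndsWell-y⁺ zero e = e refl
¬EndsWell-y⁺ (suc k) e = ¬EndsWell-y⁺ k e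

EndsWell-mark : ∀ c → EndsWell (mark c ∷ [])
EndsWell-mark red ()
EndsWell-mark green ()

replicate-y-∷ʳ : ∀ k u → replicate k y ++ y ∷ u ≡ y ∷ replicate k y ++ u
replicate-y-∷ʳ zero u = refl
replicate-y-∷ʳ (suc k) u = cong (y ∷_) (replicate-y-∷ʳ k u)

EndsWell-φ : ∀ p → EndsWell (φ p)
EndsWell-φ [] = tt
EndsWell-φ ((a , c) ∷ p) = subst EndsWell φ-split (EndsWell-++⁺ (φ p ++ replicate k y) (EndsWell-mark c))
  where
  k = a ∸ nextPart p ∸ gap c
  φ-split : (φ p ++ replicate k y) ++ mark c ∷ [] ≡ φ ((a , c) ∷ p)
  φ-split = trans (++-assoc (φ p) (replicate k y) (mark c ∷ []))
                  (cong (φ p ++_) (sym (labelSegment≡segment (a ∸ nextPart p) c)))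

numX-φ : ∀ p → numX (φ p) ≡ numRed p
numX-φ [] = refl
numX-φ ((a , red) ∷ p) = trans (numX-++ (φ p) _)
  (trans (cong₂ _+_ (numX-φ p) (numX-replicate-y (a ∸ nextPart p ∸ 1) (x ∷ []))) (+-comm (numRed p) 1))
numX-φ ((a , green) ∷ p) = trans (numX-++ (φ p) _)
  (trans (cong₂ _+_ (numX-φ p) (numX-replicate-y (a ∸ nextPart p ∸ 2) (z ∷ []))) (+-identityʳ (numRed p)))

numZ-φ : ∀ p → numZ (φ p) ≡ numGreen p
numZ-φ [] = refl
numZ-φ ((a , red) ∷ p) = trans (numZ-++ (φ p) _)
  (trans (cong₂ _+_ (numZ-φ p) (numZ-replicate-y (a ∸ nextPart p ∸ 1) (x ∷ []))) (+-identityʳ (numGreen p)))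
numZ-φ ((a , green) ∷ p) = trans (numZ-++ (φ p) _)
  (trans (cong₂ _+_ (numZ-φ p) (numZ-replicate-y (a ∸ nextPart p ∸ 2) (z ∷ []))) (+-comm (numGreen p) 1))

width-φ : ∀ p → Admissible p → width (φ p) ≡ nextPart p
width-φ [] _ = refl
width-φ ((a , c) ∷ p) adm = begin
  width (φ p ++ labelSegment (a ∸ b) c)     ≡⟨ width-++ (φ p) _ ⟩
  width (φ p) + width (labelSegment (a ∸ b) c)
    ≡⟨ cong₂ _+_ (width-φ p (admissible-tail c p adm))
                 (trans (cong width (labelSegment≡segment (a ∸ b) c)) (width-segment c k)) ⟩
  b + (k + gap c)                           ≡⟨ segment-height (gap c) (admissible-head c p adm) ⟩
  a                                         ∎
  where
  b = nextPart p
  k = a ∸ b ∸ gap c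

weightAfter-φ : ∀ p → Admissible p → weightAfter 0 (φ p) ≡ size p
weightAfter-φ [] _ = refl
weightAfter-φ ((a , c) ∷ p) adm = begin
  weightAfter 0 (φ p ++ labelSegment (a ∸ b) c)
    ≡⟨ weightAfter-++ 0 (φ p) _ ⟩
  weightAfter 0 (φ p) + weightAfter (width (φ p)) (labelSegment (a ∸ b) c)
    ≡⟨ cong₂ _+_ (weightAfter-φ p admₚ)
                 (cong₂ weightAfter (width-φ p admₚ) (labelSegment≡segment (a ∸ b) c)) ⟩
  size p + weightAfter b (segment c k)
    ≡⟨ cong (size p +_) (weightAfter-segment b c k) ⟩
  size p + (b + (k + gap c))
    ≡⟨ cong (size p +_) (segment-height (gap c) (admissible-head c p adm)) ⟩
  size p + a
    ≡⟨ +-comm (size p) a ⟩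
  a + size p
    ∎
  where
  b = nextPart p
  k = a ∸ b ∸ gap c
  admₚ = admissible-tail c p adm

weight-φ : ∀ p → Admissible p → weight (φ p) ≡ size p
weight-φ p adm = trans (weightFrom≡weightAfter 0 0 (φ p)) (weightAfter-φ p adm)

φ-InW : ∀ {n k ℓ} p → InL1 n k ℓ p → InW n k ℓ (φ p)
φ-InW p l@(_ , _ , _ , refl , refl , refl) =
  EndsWell-φ p , weight-φ p (InL1⇒Admissible p l) , numX-φ p , numZ-φ p

addPart : Color → ℕ → TwoColorPartition → TwoColorPartition
addPart c k p = (nextPart p + (k + gap c) , c) ∷ p

-- decode k p u: p holds the parts read so far, k the letters y read since.
decode : ℕ → TwoColorPartition → Word → TwoColorPartition
decode k p [] = p
decode k p (x ∷ u) = decode 0 (addPart red k p) u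
decode k p (y ∷ u) = decode (suc k) p u
decode k p (z ∷ u) = decode 0 (addPart green k p) u

ψ : Word → TwoColorPartition
ψ = decode 0 []

decode-mark : ∀ c k p u → decode k p (mark c ∷ u) ≡ decode 0 (addPart c k p) u
decode-mark red k p u = refl
decode-mark green k p u = refl

decode-replicate-y : ∀ k p m u → decode k p (replicate m y ++ u) ≡ decode (k + m) p u
decode-replicate-y k p zero u = cong (λ j → decode j p u) (sym (+-identityʳ k))
decode-replicate-y k p (suc m) u =
  trans (decode-replicate-y (suc k) p m u) (cong (λ j → decode j p u) (sym (+-suc k m)))

addPart-admissible : ∀ c k p → Admissible p → Admissible (addPart c k p)
addPart-admissible c k p adm = admissible-∷ c p adm
  (≤-trans (+-monoˡ-≤ (nextPart p) (m≤n+m (gap c) k)) (≤-reflexive (+-comm (k + gap c) (nextPart p))))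

decode-admissible : ∀ k p u → Admissible p → Admissible (decode k p u)
decode-admissible k p [] adm = adm
decode-admissible k p (x ∷ u) adm = decode-admissible 0 _ u (addPart-admissible red k p adm)
decode-admissible k p (y ∷ u) adm = decode-admissible (suc k) p u adm
decode-admissible k p (z ∷ u) adm = decode-admissible 0 _ u (addPart-admissible green k p adm)

φ-addPart : ∀ c k p → φ (addPart c k p) ≡ φ p ++ segment c k
φ-addPart c k p = cong (φ p ++_) (begin
  labelSegment (b + (k + gap c) ∸ b) c       ≡⟨ labelSegment≡segment _ c ⟩
  segment c (b + (k + gap c) ∸ b ∸ gap c)    ≡⟨ cong (λ d → segment c (d ∸ gap c)) (m+n∸m≡n b (k + gap c)) ⟩
  segment c (k + gap c ∸ gap c)              ≡⟨ cong (segment c) (m+n∸n≡m k (gap c)) ⟩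
  segment c k                                ∎)
  where b = nextPart p

addPart-segment : ∀ {a} c p → gap c + nextPart p ≤ a → addPart c (a ∸ nextPart p ∸ gap c) p ≡ (a , c) ∷ p
addPart-segment c p le = cong (λ a → (a , c) ∷ p) (segment-height (gap c) le)

decode-φ : ∀ p u → Admissible p → decode 0 [] (φ p ++ u) ≡ decode 0 p u
decode-φ [] u _ = refl
decode-φ ((a , c) ∷ p) u adm = begin
  decode 0 [] ((φ p ++ labelSegment (a ∸ b) c) ++ u)
    ≡⟨ cong (decode 0 []) (++-assoc (φ p) _ u) ⟩
  decode 0 [] (φ p ++ labelSegment (a ∸ b) c ++ u)
    ≡⟨ decode-φ p _ (admissible-tail c p adm) ⟩
  decode 0 p (labelSegment (a ∸ b) c ++ u)
    ≡⟨ cong (λ w → decode 0 p (w ++ u)) (labelSegment≡segment (a ∸ b) c) ⟩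
  decode 0 p ((replicate k y ∷ʳ mark c) ++ u)
    ≡⟨ cong (decode 0 p) (∷ʳ-++ (replicate k y) (mark c) u) ⟩
  decode 0 p (replicate k y ++ mark c ∷ u)
    ≡⟨ decode-replicate-y 0 p k _ ⟩
  decode k p (mark c ∷ u)
    ≡⟨ decode-mark c k p u ⟩
  decode 0 (addPart c k p) u
    ≡⟨ cong (λ q → decode 0 q u) (addPart-segment c p (admissible-head c p adm)) ⟩
  decode 0 ((a , c) ∷ p) u
    ∎
  where
  b = nextPart p
  k = a ∸ b ∸ gap c

ψ-φ : ∀ p → Admissible p → ψ (φ p) ≡ p
ψ-φ p adm = trans (cong ψ (sym (++-identityʳ (φ p)))) (decode-φ p [] adm)

-- The hypothesis forbids trailing letters y, which decode would discard.
φ-decode : ∀ k p u → EndsWell (replicate k y ++ u) → φ (decode k p u) ≡ φ p ++ replicate k y ++ u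
φ-decode-mark : ∀ c k p u → EndsWell (replicate k y ++ mark c ∷ u) →
  φ (decode k p (mark c ∷ u)) ≡ φ p ++ replicate k y ++ mark c ∷ u

φ-decode zero p [] _ = sym (++-identityʳ (φ p))
φ-decode (suc k) p [] e with () ← ¬EndsWell-y⁺ k e
φ-decode k p (x ∷ u) e = φ-decode-mark red k p u e
φ-decode k p (y ∷ u) e = begin
  φ (decode (suc k) p u)
    ≡⟨ φ-decode (suc k) p u (subst EndsWell (replicate-y-∷ʳ k u) e) ⟩
  φ p ++ y ∷ replicate k y ++ u
    ≡⟨ cong (φ p ++_) (sym (replicate-y-∷ʳ k u)) ⟩
  φ p ++ replicate k y ++ y ∷ u
    ∎
φ-decode k p (z ∷ u) e = φ-decode-mark green k p u e

φ-decode-mark c k p u e = begin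
  φ (decode k p (mark c ∷ u))
    ≡⟨ cong φ (decode-mark c k p u) ⟩
  φ (decode 0 (addPart c k p) u)
    ≡⟨ φ-decode 0 _ u (EndsWell-∷⁻ u (EndsWell-++⁻ (replicate k y) e)) ⟩
  φ (addPart c k p) ++ u
    ≡⟨ cong (_++ u) (φ-addPart c k p) ⟩
  (φ p ++ segment c k) ++ u
    ≡⟨ ++-assoc (φ p) (segment c k) u ⟩
  φ p ++ (replicate k y ∷ʳ mark c) ++ u
    ≡⟨ cong (φ p ++_) (∷ʳ-++ (replicate k y) (mark c) u) ⟩
  φ p ++ replicate k y ++ mark c ∷ u
    ∎

φ-ψ : ∀ u → EndsWell u → φ (ψ u) ≡ u
φ-ψ = φ-decode 0 []

ψ-InL1 : ∀ {n k ℓ} u → InW n k ℓ u → InL1 n k ℓ (ψ u)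
ψ-InL1 u (e , refl , refl , refl) with adm@(sd , gg , ng) ← decode-admissible 0 [] u (tt , tt , tt) =
  sd , gg , ng ,
  transport weight (weight-φ (ψ u) adm) ,
  transport numX (numX-φ (ψ u)) ,
  transport numZ (numZ-φ (ψ u))
  where
  transport : ∀ (statistic : Word → ℕ) {m} → statistic (φ (ψ u)) ≡ m → m ≡ statistic u
  transport statistic eq = trans (sym eq) (cong statistic (φ-ψ u e))

φ-injective : ∀ p q → Admissible p → Admissible q → φ p ≡ φ q → p ≡ q
φ-injective p q adm-p adm-q eq = begin
  p          ≡⟨ sym (ψ-φ p adm-p) ⟩
  ψ (φ p)    ≡⟨ cong ψ eq ⟩
  ψ (φ q)    ≡⟨ ψ-φ q adm-q ⟩
  q          ∎

proposition2p1 : (n k ℓ : ℕ) →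
    ((p : TwoColorPartition) → InL1 n k ℓ p → InW n k ℓ (φ p)) ×
    ((p q : TwoColorPartition) → InL1 n k ℓ p → InL1 n k ℓ q → φ p ≡ φ q → p ≡ q) ×
    ((u : Word) → InW n k ℓ u → Σ TwoColorPartition (λ p → InL1 n k ℓ p × φ p ≡ u))
proposition2p1 n k ℓ =
  φ-InW ,
  (λ p q l₁ l₂ → φ-injective p q (InL1⇒Admissible p l₁) (InL1⇒Admissible q l₂)) ,
  (λ u w → ψ u , ψ-InL1 u w , φ-ψ u (proj₁ w))
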